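{- Let $G$ be a connected graph of order $n\geq 3$. Then $\operatorname{car}(G)=n-1$ if and only if $G$ is isomorphic to the cycle $C_n$.
   Context: All graphs are finite, simple and undirected; $G[X]$ denotes the subgraph induced by $X$. A set $S\subseteq V(G)$ is cycle convex if for every $u\in V(G)\setminus S$ the graph $G[S\cup\{u\}]$ contains no cycle passing through $u$. The cycle convex hull $\langle S\rangle$ is the smallest cycle convex set containing $S$. A set $S$ is Carathéodory independent if there is $p\in\langle S\rangle$ with $p\notin \bigcup_{a\in S}\langle S\setminus\{a\}\rangle$. The Carathéodory number $\operatorname{car}(G)$ is the maximum cardinality of a Carathéodory independent set of $G$. -}

module Defs where

open import Data.Nat using (ℕ; zero; suc; _≤_; _+_)
open import Data.Fin using (Fin; zero; suc; toℕ; inject₁; fromℕ)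
open import Data.Fin.Subset using (Subset; _∈_; _∉_; _⊆_; _∪_; ⁅_⁆; _-_; ∣_∣)
open import Data.Bool using (Bool; true; false)
open import Data.Product using (Σ; ∃; ∃-syntax; _×_; _,_)
open import Data.Sum using (_⊎_)
open import Relation.Nullary using (¬_)
open import Relation.Binary.PropositionalEquality using (_≡_)
open import Function.Definitions using (Injective; Bijective)

record Graph (n : ℕ) : Set where
  field
    adj   : Fin n → Fin n → Bool
    sym   : ∀ u v → adj u v ≡ adj v u
    irrefl : ∀ u → adj u u ≡ false

open Graph public

Edge : ∀ {n} → Graph n → Fin n → Fin n → Set
Edge G u v = adj G u v ≡ true

CycleThrough : ∀ {n} → Graph n → Subset n → Fin n → Set
CycleThrough {n} G X u =
  ∃[ k ] Σ (Fin (3 + k) → Fin n) λ c →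
    Injective _≡_ _≡_ c
    × (∀ i → c i ∈ X)
    × c zero ≡ u
    × (∀ (i : Fin (2 + k)) → Edge G (c (inject₁ i)) (c (suc i)))
    × Edge G (c (fromℕ (2 + k))) (c zero)

CycleConvex : ∀ {n} → Graph n → Subset n → Set
CycleConvex G S = ∀ u → u ∉ S → ¬ CycleThrough G (S ∪ ⁅ u ⁆) u

InHull : ∀ {n} → Graph n → Subset n → Fin n → Set
InHull {n} G S p = ∀ (T : Subset n) → S ⊆ T → CycleConvex G T → p ∈ T

CaratheodoryIndependent : ∀ {n} → Graph n → Subset n → Set
CaratheodoryIndependent G S =
  ∃[ p ] (InHull G S p × (∀ a → a ∈ S → ¬ InHull G (S - a) p))

CarEq : ∀ {n} → Graph n → ℕ → Set
CarEq {n} G c =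
  (Σ (Subset n) λ S → CaratheodoryIndependent G S × ∣ S ∣ ≡ c)
  × (∀ (S : Subset n) → CaratheodoryIndependent G S → ∣ S ∣ ≤ c)

Walk : ∀ {n} → Graph n → Fin n → Fin n → Set
Walk {n} G u v =
  ∃[ k ] Σ (Fin (suc k) → Fin n) λ w →
    w zero ≡ u × w (fromℕ k) ≡ v
    × (∀ (i : Fin k) → Edge G (w (inject₁ i)) (w (suc i)))

Connected : ∀ {n} → Graph n → Set
Connected {n} G = ∀ (u v : Fin n) → Walk G u v

CycAdj : ∀ {n} → Fin n → Fin n → Set
CycAdj {n} i j =
  toℕ j ≡ suc (toℕ i) ⊎ toℕ i ≡ suc (toℕ j)
  ⊎ (toℕ i ≡ 0 × suc (toℕ j) ≡ n) ⊎ (toℕ j ≡ 0 × suc (toℕ i) ≡ n)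

IsoToCycle : ∀ {n} → Graph n → Set
IsoToCycle {n} G =
  Σ (Fin n → Fin n) λ f →
    Bijective _≡_ _≡_ f
    × (∀ i j → (Edge G (f i) (f j) → CycAdj i j) × (CycAdj i j → Edge G (f i) (f j)))

module Submission where

-- If G ≅ C_n, the Hamiltonian cycle through a vertex x puts x in the hull of V ∖ {x}. In a
-- connected graph of maximum degree 2 every cycle passes through every vertex, so V ∖ {x, a} is
-- convex for a ≠ x; hence V ∖ {x} is Carathéodory independent. An independent set with at least
-- two elements never contains its witness, which bounds car(G) by n − 1.
--
-- Conversely, let S be independent of size n − 1 with witness p, so S = V ∖ {p}. As p ∈ ⟨S⟩, S
-- is not convex, so there is a cycle through p; as p ∉ ⟨S − a⟩, every cycle through p passes
-- through every a ≠ p. A chord would shortcut such a cycle into one through p that misses a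
-- vertex, so every cycle through p is a chordless Hamiltonian cycle, whence G ≅ C_n.
-- Constructively that cycle exists only up to double negation, so the isomorphism is taken to be
-- a greedy walk from p, which a suitably oriented cycle through p must follow; being an
-- isomorphism is decidable, hence stable.

open import Defs hiding (sym)
open import Data.Bool using (true)
import Data.Bool as Bool
open import Data.Fin using (Fin; zero; suc; toℕ; inject₁; fromℕ; fromℕ<)
open import Data.Fin.Properties
  using (toℕ-injective; toℕ<n; toℕ-fromℕ; toℕ-fromℕ<; toℕ-inject₁; any?; injective⇒≤; _≟_)
open import Data.Fin.Subset
  using (Subset; _∈_; _∉_; _⊆_; _∪_; _─_; _-_; ⁅_⁆; ∁; ∣_∣; ⊤; inside; outside)
open import Data.Fin.Subset.Properties
  using (_∈?_; ∈⊤; x∈⁅x⁆; x≢y⇒x∉⁅y⁆; x∈⁅y⁆⇒x≡y; x∉p⇒x∈∁p; x∈∁p⇒x∉p; x∈p∪q⁺; x∈p∪q⁻;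
         x∈p∧x≢y⇒x∈p-y; p─q⊆p; p⊆q⇒∣p∣≤∣q∣; ∣∁p∣≡n∸∣p∣; ∣⁅x⁆∣≡1; x∈p⇒∣p-x∣<∣p∣)
open import Data.Nat using (ℕ; zero; suc; pred; _+_; _∸_; _≤_; _<_; z≤n; s≤s; _≤?_; _<?_)
open import Data.Nat.Properties
  using (≤-refl; ≤-trans; <-trans; ≤-<-trans; ≤-reflexive; ≤-pred; ≤-antisym; <⇒≤; <⇒≱; ≤⇒≯;
         ≰⇒>; ≮⇒≥; <⇒≢; ≤∧≢⇒<; <-cmp; <-irrefl; n≤1+n; n<1+n; m≤m+n; m≤n+m; m<m+n; m≢1+n+m;
         m<n⇒0<n∸m; m⊓n≤n; m≤n⇒m⊓n≡m; m∸n≤m; m∸[m∸n]≡n; m+n∸n≡m; m+[n∸m]≡n; m∸n+n≡m;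
         +-∸-assoc; +-cancelʳ-≡; +-cancelʳ-≤; +-monoˡ-<; ∸-monoʳ-<; ∸-monoˡ-≤; anyUpTo?)
  renaming (_≟_ to _≟ℕ_)
open import Data.Product using (Σ; ∃; ∃₂; _×_; _,_; proj₁; proj₂; uncurry)
open import Data.Sum using (_⊎_; inj₁; inj₂; [_,_]′)
import Data.Sum as Sum
open import Data.Vec using (_∷_; here; there)
open import Function using (_∘_; id)
open import Function.Bundles using (_⇔_; mk⇔)
open import Function.Consequences.Propositional using (surjective⇒strictlySurjective)
open import Function.Definitions using (Injective; Surjective; Bijective)
open import Relation.Binary.Definitions using (tri<; tri≈; tri>)
open import Relation.Binary.PropositionalEquality
  using (_≡_; _≢_; refl; sym; trans; cong; cong₂; subst; subst₂; module ≡-Reasoning)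
open import Relation.Nullary using (¬_; Dec; yes; no; contradiction; Stable; ¬¬-map)
open import Relation.Nullary.Decidable using (_×-dec_; _⊎-dec_; ¬?; decidable-stable)

-- Graphs and vertex sets

Edge-sym : ∀ {n} (G : Graph n) {u v} → Edge G u v → Edge G v u
Edge-sym G {u} {v} e = trans (Graph.sym G v u) e

Edge⇒≢ : ∀ {n} (G : Graph n) {u v} → Edge G u v → u ≢ v
Edge⇒≢ G {u} e refl with trans (sym e) (irrefl G u)
... | ()

Edge? : ∀ {n} (G : Graph n) u v → Dec (Edge G u v)
Edge? G u v = adj G u v Bool.≟ true

MaxDegree≤2 : ∀ {n} → Graph n → Set
MaxDegree≤2 G = ∀ {w x y z} → Edge G w x → Edge G w y → Edge G w z → x ≡ y ⊎ x ≡ z ⊎ y ≡ z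

preserved-along-walk : ∀ {n} (G : Graph n) (P : Fin n → Set) → (∀ {x y} → P x → Edge G x y → P y) →
                       ∀ {u v} → Walk G u v → P u → P v
preserved-along-walk {n} G P step (k , w , refl , refl , w-step) = along k w w-step
  where
  along : ∀ k (w : Fin (suc k) → Fin n) → (∀ i → Edge G (w (inject₁ i)) (w (suc i))) →
          P (w zero) → P (w (fromℕ k))
  along zero    w w-step Pw = Pw
  along (suc k) w w-step Pw = along k (w ∘ suc) (w-step ∘ suc) (step Pw (w-step zero))

x∈p─q⇒x∉q : ∀ {n} (p q : Subset n) {x} → x ∈ p ─ q → x ∉ q
x∈p─q⇒x∉q (inside ∷ p) (outside ∷ q) here ()
x∈p─q⇒x∉q (_ ∷ p) (_ ∷ q) (there x∈p─q) (there x∈q) = x∈p─q⇒x∉q p q x∈p─q x∈q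

x≢y⇒x∈∁⁅y⁆ : ∀ {n} {x y : Fin n} → x ≢ y → x ∈ ∁ ⁅ y ⁆
x≢y⇒x∈∁⁅y⁆ = x∉p⇒x∈∁p ∘ x≢y⇒x∉⁅y⁆

x∉∁⁅x⁆ : ∀ {n} (x : Fin n) → x ∉ ∁ ⁅ x ⁆
x∉∁⁅x⁆ x x∈∁⁅x⁆ = x∈∁p⇒x∉p x∈∁⁅x⁆ (x∈⁅x⁆ x)

module _ {n : ℕ} where

  ∣∁⁅x⁆∣≡n∸1 : ∀ (x : Fin n) → ∣ ∁ ⁅ x ⁆ ∣ ≡ n ∸ 1
  ∣∁⁅x⁆∣≡n∸1 x = trans (∣∁p∣≡n∸∣p∣ ⁅ x ⁆) (cong (n ∸_) (∣⁅x⁆∣≡1 x))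

  x∉p⇒p⊆∁⁅x⁆ : ∀ {p : Subset n} {x} → x ∉ p → p ⊆ ∁ ⁅ x ⁆
  x∉p⇒p⊆∁⁅x⁆ x∉p y∈p = x≢y⇒x∈∁⁅y⁆ λ { refl → x∉p y∈p }

  x∉p⇒∣p∣≤n∸1 : ∀ {p : Subset n} {x} → x ∉ p → ∣ p ∣ ≤ n ∸ 1
  x∉p⇒∣p∣≤n∸1 {x = x} x∉p = ≤-trans (p⊆q⇒∣p∣≤∣q∣ (x∉p⇒p⊆∁⁅x⁆ x∉p)) (≤-reflexive (∣∁⁅x⁆∣≡n∸1 x))

  ∣p∣≡n∸1⇒∁⁅x⁆⊆p : ∀ {p : Subset n} {x} → ∣ p ∣ ≡ n ∸ 1 → x ∉ p → ∁ ⁅ x ⁆ ⊆ p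
  ∣p∣≡n∸1⇒∁⁅x⁆⊆p {p} {x} ∣p∣≡n∸1 x∉p {y} y∈∁⁅x⁆ with y ∈? p
  ... | yes y∈p = y∈p
  ... | no  y∉p = contradiction (p⊆q⇒∣p∣≤∣q∣ p⊆∁⁅x⁆-y) (<⇒≱ ∣∁⁅x⁆-y∣<∣p∣)
    where
    p⊆∁⁅x⁆-y : p ⊆ ∁ ⁅ x ⁆ - y
    p⊆∁⁅x⁆-y z∈p = x∈p∧x≢y⇒x∈p-y (x∉p⇒p⊆∁⁅x⁆ x∉p z∈p) λ { refl → y∉p z∈p }
    ∣∁⁅x⁆-y∣<∣p∣ : ∣ ∁ ⁅ x ⁆ - y ∣ < ∣ p ∣
    ∣∁⁅x⁆-y∣<∣p∣ = subst (∣ ∁ ⁅ x ⁆ - y ∣ <_) (trans (∣∁⁅x⁆∣≡n∸1 x) (sym ∣p∣≡n∸1)) (x∈p⇒∣p-x∣<∣p∣ y∈∁⁅x⁆)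

-- Cyclic adjacency of positions

-- CycAdj i j unfolds to CycAdjℕ n (toℕ i) (toℕ j).
CycAdjℕ : ℕ → ℕ → ℕ → Set
CycAdjℕ n s t = t ≡ suc s ⊎ s ≡ suc t ⊎ (s ≡ 0 × suc t ≡ n) ⊎ (t ≡ 0 × suc s ≡ n)

CycAdjℕ? : ∀ n s t → Dec (CycAdjℕ n s t)
CycAdjℕ? n s t =
  (t ≟ℕ suc s) ⊎-dec (s ≟ℕ suc t) ⊎-dec ((s ≟ℕ 0) ×-dec (suc t ≟ℕ n)) ⊎-dec ((t ≟ℕ 0) ×-dec (suc s ≟ℕ n))

CycAdjℕ-sym : ∀ {n s t} → CycAdjℕ n s t → CycAdjℕ n t s
CycAdjℕ-sym (inj₁ t≡1+s)              = inj₂ (inj₁ t≡1+s)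
CycAdjℕ-sym (inj₂ (inj₁ s≡1+t))       = inj₁ s≡1+t
CycAdjℕ-sym (inj₂ (inj₂ (inj₁ wrap))) = inj₂ (inj₂ (inj₂ wrap))
CycAdjℕ-sym (inj₂ (inj₂ (inj₂ wrap))) = inj₂ (inj₂ (inj₁ wrap))

CycSucc CycPred : ℕ → ℕ → ℕ → Set
CycSucc n s t = t ≡ suc s ⊎ (t ≡ 0 × suc s ≡ n)
CycPred n s t = s ≡ suc t ⊎ (s ≡ 0 × suc t ≡ n)

CycAdjℕ⇒CycSucc⊎CycPred : ∀ {n s t} → CycAdjℕ n s t → CycSucc n s t ⊎ CycPred n s t
CycAdjℕ⇒CycSucc⊎CycPred (inj₁ t≡1+s)              = inj₁ (inj₁ t≡1+s)
CycAdjℕ⇒CycSucc⊎CycPred (inj₂ (inj₁ s≡1+t))       = inj₂ (inj₁ s≡1+t)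
CycAdjℕ⇒CycSucc⊎CycPred (inj₂ (inj₂ (inj₁ wrap))) = inj₂ (inj₂ wrap)
CycAdjℕ⇒CycSucc⊎CycPred (inj₂ (inj₂ (inj₂ wrap))) = inj₁ (inj₂ wrap)

CycSucc-unique : ∀ {n s a b} → a < n → b < n → CycSucc n s a → CycSucc n s b → a ≡ b
CycSucc-unique _   _   (inj₁ refl)       (inj₁ refl)       = refl
CycSucc-unique a<n _   (inj₁ refl)       (inj₂ (_ , refl)) = contradiction a<n (<-irrefl refl)
CycSucc-unique _   b<n (inj₂ (_ , refl)) (inj₁ refl)       = contradiction b<n (<-irrefl refl)
CycSucc-unique _   _   (inj₂ (refl , _)) (inj₂ (refl , _)) = refl

CycPred-unique : ∀ {n s a b} → CycPred n s a → CycPred n s b → a ≡ b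
CycPred-unique (inj₁ refl)        (inj₁ s≡1+b)       = cong pred s≡1+b
CycPred-unique (inj₁ refl)        (inj₂ (() , _))
CycPred-unique (inj₂ (() , _))    (inj₁ refl)
CycPred-unique (inj₂ (_ , 1+a≡n)) (inj₂ (_ , 1+b≡n)) = cong pred (trans 1+a≡n (sym 1+b≡n))

CycAdjℕ-three : ∀ {n s a b c} → a < n → b < n → c < n →
                CycAdjℕ n s a → CycAdjℕ n s b → CycAdjℕ n s c → a ≡ b ⊎ a ≡ c ⊎ b ≡ c
CycAdjℕ-three a<n b<n c<n sa sb sc
  with CycAdjℕ⇒CycSucc⊎CycPred sa | CycAdjℕ⇒CycSucc⊎CycPred sb | CycAdjℕ⇒CycSucc⊎CycPred sc
... | inj₁ a⁺ | inj₁ b⁺ | _       = inj₁ (CycSucc-unique a<n b<n a⁺ b⁺)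
... | inj₂ a⁻ | inj₂ b⁻ | _       = inj₁ (CycPred-unique a⁻ b⁻)
... | inj₁ a⁺ | inj₂ _  | inj₁ c⁺ = inj₂ (inj₁ (CycSucc-unique a<n c<n a⁺ c⁺))
... | inj₁ _  | inj₂ b⁻ | inj₂ c⁻ = inj₂ (inj₂ (CycPred-unique b⁻ c⁻))
... | inj₂ _  | inj₁ b⁺ | inj₁ c⁺ = inj₂ (inj₂ (CycSucc-unique b<n c<n b⁺ c⁺))
... | inj₂ a⁻ | inj₁ _  | inj₂ c⁻ = inj₂ (inj₁ (CycPred-unique a⁻ c⁻))

chord-gap : ∀ {k s t} → s < t → t < 3 + k → ¬ CycAdjℕ (3 + k) s t →
            ∃₂ λ d k′ → 1 ≤ d × k′ + d ≡ k × suc s + d ≡ t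
chord-gap {k} {s} {t} s<t t< ¬adj = d , k ∸ d , d≥1 , m∸n+n≡m (d≤k s s+1+d≤2+k ¬wrap) , s+1+d≡t
  where
  d : ℕ
  d = t ∸ suc s

  s+1+d≡t : suc s + d ≡ t
  s+1+d≡t = m+[n∸m]≡n s<t

  d≥1 : 1 ≤ d
  d≥1 = m<n⇒0<n∸m (≤∧≢⇒< s<t (¬adj ∘ inj₁ ∘ sym))

  s+1+d≤2+k : suc s + d ≤ 2 + k
  s+1+d≤2+k = subst (_≤ 2 + k) (sym s+1+d≡t) (≤-pred t<)

  ¬wrap : s ≡ 0 → suc s + d ≢ 2 + k
  ¬wrap s≡0 s+1+d≡2+k = ¬adj (inj₂ (inj₂ (inj₁ (s≡0 , cong suc (trans (sym s+1+d≡t) s+1+d≡2+k)))))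

  d≤k : ∀ i → suc i + d ≤ 2 + k → (i ≡ 0 → suc i + d ≢ 2 + k) → d ≤ k
  d≤k zero    le ≢2+k = ≤-pred (≤-pred (≤∧≢⇒< le (≢2+k refl)))
  d≤k (suc i) le _    = ≤-trans (m≤n+m d i) (≤-pred (≤-pred le))

skip : ℕ → ℕ → ℕ → ℕ
skip s d x with x ≤? s
... | yes _ = x
... | no  _ = x + d

module _ {s d : ℕ} where

  skip-low : ∀ {x} → x ≤ s → skip s d x ≡ x
  skip-low {x} x≤s with x ≤? s
  ... | yes _   = refl
  ... | no  x≰s = contradiction x≤s x≰s

  skip-high : ∀ {x} → s < x → skip s d x ≡ x + d
  skip-high {x} s<x with x ≤? s
  ... | yes x≤s = contradiction s<x (≤⇒≯ x≤s)
  ... | no  _   = refl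

  skip-injective : ∀ {x y} → skip s d x ≡ skip s d y → x ≡ y
  skip-injective {x} {y} eq with x ≤? s | y ≤? s
  ... | yes _   | yes _   = eq
  ... | no  _   | no  _   = +-cancelʳ-≡ d x y eq
  ... | yes x≤s | no  y≰s = contradiction (≤-trans (m≤m+n y d) (subst (_≤ s) eq x≤s)) y≰s
  ... | no  x≰s | yes y≤s = contradiction (≤-trans (m≤m+n x d) (subst (_≤ s) (sym eq) y≤s)) x≰s

  skip≢suc : 1 ≤ d → ∀ x → skip s d x ≢ suc s
  skip≢suc d≥1 x with x ≤? s
  ... | yes x≤s = λ x≡s+1 → <-irrefl x≡s+1 (s≤s x≤s)
  ... | no  x≰s = λ x+d≡s+1 → <-irrefl (sym x+d≡s+1) (≤-<-trans (≰⇒> x≰s) (m<m+n x d≥1))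

-- Cycles

-- Indexed by ℕ rather than Fin (3 + k), so that shortcuts and reversal are plain index
-- arithmetic; the positions from length on are junk.
record Cycle {n} (G : Graph n) (u : Fin n) : Set where
  field
    k            : ℕ
    at           : ℕ → Fin n
    at-injective : ∀ {s t} → s < 3 + k → t < 3 + k → at s ≡ at t → s ≡ t
    at-zero      : at 0 ≡ u
    at-step      : ∀ {t} → suc t < 3 + k → Edge G (at t) (at (suc t))
    at-close     : Edge G (at (2 + k)) (at 0)

  length : ℕ
  length = 3 + k

open Cycle using (at; length)

module _ {n} {G : Graph n} {u : Fin n} where

  OnCycle : Cycle G u → Fin n → Set
  OnCycle C v = ∃ λ t → t < length C × at C t ≡ v

  onCycle? : (C : Cycle G u) → ∀ v → Dec (OnCycle C v)
  onCycle? C v = anyUpTo? (λ t → at C t ≟ v) (length C)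

  Within : Cycle G u → Subset n → Set
  Within C X = ∀ {t} → t < length C → at C t ∈ X

  Hamiltonian : Cycle G u → Set
  Hamiltonian C = ∀ v → OnCycle C v

  Chordless : Cycle G u → Set
  Chordless C = ∀ {s t} → s < length C → t < length C → Edge G (at C s) (at C t) → CycAdjℕ (length C) s t

  Hamiltonian∧Within⇒∈ : ∀ {X} (C : Cycle G u) → Hamiltonian C → Within C X → ∀ v → v ∈ X
  Hamiltonian∧Within⇒∈ C ham C⊆X v with ham v
  ... | t , t< , refl = C⊆X t<

  Hamiltonian⇒length≡n : (C : Cycle G u) → Hamiltonian C → length C ≡ n
  Hamiltonian⇒length≡n C ham = ≤-antisym (injective⇒≤ at-injective) (injective⇒≤ position-injective)
    where
    at-injective : Injective _≡_ _≡_ (at C ∘ toℕ)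
    at-injective {i} {j} eq = toℕ-injective (Cycle.at-injective C (toℕ<n i) (toℕ<n j) eq)
    position : Fin n → Fin (length C)
    position v = fromℕ< (proj₁ (proj₂ (ham v)))
    at-position : ∀ v → at C (toℕ (position v)) ≡ v
    at-position v = trans (cong (at C) (toℕ-fromℕ< _)) (proj₂ (proj₂ (ham v)))
    position-injective : Injective _≡_ _≡_ position
    position-injective {v} {w} eq =
      trans (sym (at-position v)) (trans (cong (at C ∘ toℕ) eq) (at-position w))

clamp : (k : ℕ) → ℕ → Fin (suc k)
clamp k t = fromℕ< (s≤s (m⊓n≤n t k))

toℕ-clamp : ∀ {k t} → t ≤ k → toℕ (clamp k t) ≡ t
toℕ-clamp t≤k = trans (toℕ-fromℕ< _) (m≤n⇒m⊓n≡m t≤k)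

module _ {n} {G : Graph n} {X : Subset n} {u : Fin n} where

  fromCycleThrough : CycleThrough G X u → Σ (Cycle G u) λ C → Within C X
  fromCycleThrough (k , c , c-injective , c∈X , c-zero , c-step , c-close) = C , λ _ → c∈X _
    where
    at′ : ℕ → Fin n
    at′ t = c (clamp (2 + k) t)

    at′-injective : ∀ {s t} → s < 3 + k → t < 3 + k → at′ s ≡ at′ t → s ≡ t
    at′-injective {s} {t} s< t< eq = begin
      s                       ≡⟨ toℕ-clamp (≤-pred s<) ⟨
      toℕ (clamp (2 + k) s)   ≡⟨ cong toℕ (c-injective eq) ⟩
      toℕ (clamp (2 + k) t)   ≡⟨ toℕ-clamp (≤-pred t<) ⟩
      t                       ∎
      where open ≡-Reasoning

    inject₁-clamp : ∀ {t} → suc t < 3 + k → inject₁ (clamp (1 + k) t) ≡ clamp (2 + k) t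
    inject₁-clamp t+1< = toℕ-injective (trans (toℕ-inject₁ _)
      (trans (toℕ-clamp (≤-pred (≤-pred t+1<))) (sym (toℕ-clamp (≤-trans (n≤1+n _) (≤-pred t+1<))))))

    fromℕ-clamp : fromℕ (2 + k) ≡ clamp (2 + k) (2 + k)
    fromℕ-clamp = toℕ-injective (trans (toℕ-fromℕ _) (sym (toℕ-clamp ≤-refl)))

    C : Cycle G u
    C = record
      { k            = k
      ; at           = at′
      ; at-injective = at′-injective
      ; at-zero      = c-zero
      ; at-step      = λ {t} t+1< → subst (λ i → Edge G (c i) (c (suc (clamp (1 + k) t))))
                                            (inject₁-clamp t+1<) (c-step (clamp (1 + k) t))
      ; at-close     = subst (λ i → Edge G (c i) (c zero)) fromℕ-clamp c-close
      }

  toCycleThrough : (C : Cycle G u) → Within C X → CycleThrough G X u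
  toCycleThrough C C⊆X = k , at C ∘ toℕ , injective , C⊆X ∘ toℕ<n , at-zero , step , close
    where
    open Cycle C using (k; at-injective; at-zero; at-step; at-close)
    injective : Injective _≡_ _≡_ (at C ∘ toℕ)
    injective {i} {j} eq = toℕ-injective (at-injective (toℕ<n i) (toℕ<n j) eq)
    step : ∀ (i : Fin (2 + k)) → Edge G (at C (toℕ (inject₁ i))) (at C (suc (toℕ i)))
    step i = subst (λ t → Edge G (at C t) (at C (suc (toℕ i)))) (sym (toℕ-inject₁ i))
                   (at-step (s≤s (toℕ<n i)))
    close : Edge G (at C (toℕ (fromℕ (2 + k)))) (at C 0)
    close = subst (λ t → Edge G (at C t) (at C 0)) (sym (toℕ-fromℕ _)) at-close

module _ {n} {G : Graph n} {u : Fin n} (C : Cycle G u) where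
  open Cycle C using (k; at-injective; at-zero; at-step; at-close)

  CycAdjℕ⇒Edge : ∀ {s t} → s < length C → t < length C → CycAdjℕ (length C) s t → Edge G (at C s) (at C t)
  CycAdjℕ⇒Edge _  t< (inj₁ refl)        = at-step t<
  CycAdjℕ⇒Edge s< _  (inj₂ (inj₁ refl)) = Edge-sym G (at-step s<)
  CycAdjℕ⇒Edge _  _  (inj₂ (inj₂ (inj₁ (refl , 1+t≡len)))) =
    subst (λ t → Edge G (at C 0) (at C t)) (sym (cong pred 1+t≡len)) (Edge-sym G at-close)
  CycAdjℕ⇒Edge _  _  (inj₂ (inj₂ (inj₂ (refl , 1+s≡len)))) =
    subst (λ s → Edge G (at C s) (at C 0)) (sym (cong pred 1+s≡len)) at-close

  two-neighbours : ∀ {t} → t < length C →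
                   ∃₂ λ a b → a < length C × b < length C × a ≢ b ×
                              Edge G (at C t) (at C a) × Edge G (at C t) (at C b)
  two-neighbours {zero} _ =
    2 + k , 1 , ≤-refl , s≤s (s≤s z≤n) , (λ ()) , Edge-sym G at-close , at-step (s≤s (s≤s z≤n))
  two-neighbours {suc t} t+1< with suc (suc t) <? length C
  ... | yes t+2< = t , suc (suc t) , <-trans (n<1+n t) t+1< , t+2< , (λ ()) ,
                   Edge-sym G (at-step t+1<) , at-step t+2<
  ... | no  t+2≮ = t , 0 , <-trans (n<1+n t) t+1< , s≤s z≤n , t≢0 ,
                   Edge-sym G (at-step t+1<) , subst (λ i → Edge G (at C i) (at C 0)) (sym t+1≡2+k) at-close
    where
    t+1≡2+k : suc t ≡ 2 + k
    t+1≡2+k = cong pred (≤-antisym t+1< (≮⇒≥ t+2≮))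
    t≢0 : t ≢ 0
    t≢0 refl with cong pred t+1≡2+k
    ... | ()

  reindex : (k′ : ℕ) (ι : ℕ → ℕ) → ι 0 ≡ 0 →
            (∀ {x} → x < 3 + k′ → ι x < length C) →
            (∀ {x y} → x < 3 + k′ → y < 3 + k′ → ι x ≡ ι y → x ≡ y) →
            (∀ {x} → suc x < 3 + k′ → Edge G (at C (ι x)) (at C (ι (suc x)))) →
            Edge G (at C (ι (2 + k′))) (at C (ι 0)) →
            Cycle G u
  reindex k′ ι ι-zero ι< ι-injective ι-step ι-close = record
    { k            = k′
    ; at           = at C ∘ ι
    ; at-injective = λ x< y< eq → ι-injective x< y< (at-injective (ι< x<) (ι< y<) eq)
    ; at-zero      = trans (cong (at C) ι-zero) at-zero
    ; at-step      = ι-step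
    ; at-close     = ι-close
    }

  reverse : Cycle G u
  reverse = reindex k mirror refl mirror< mirror-injective mirror-step mirror-close
    where
    mirror : ℕ → ℕ
    mirror zero    = zero
    mirror (suc t) = length C ∸ suc t

    mirror< : ∀ {x} → x < length C → mirror x < length C
    mirror< {zero}  x< = x<
    mirror< {suc x} x< = ∸-monoʳ-< (s≤s z≤n) (<⇒≤ x<)

    mirror-injective : ∀ {x y} → x < length C → y < length C → mirror x ≡ mirror y → x ≡ y
    mirror-injective {zero}  {zero}  _  _  _  = refl
    mirror-injective {zero}  {suc y} _  y< eq = contradiction eq (<⇒≢ (m<n⇒0<n∸m y<))
    mirror-injective {suc x} {zero}  x< _  eq = contradiction (sym eq) (<⇒≢ (m<n⇒0<n∸m x<))
    mirror-injective {suc x} {suc y} x< y< eq = begin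
      suc x                         ≡⟨ m∸[m∸n]≡n (<⇒≤ x<) ⟨
      length C ∸ (length C ∸ suc x) ≡⟨ cong (length C ∸_) eq ⟩
      length C ∸ (length C ∸ suc y) ≡⟨ m∸[m∸n]≡n (<⇒≤ y<) ⟩
      suc y                         ∎
      where open ≡-Reasoning

    mirror-step : ∀ {x} → suc x < length C → Edge G (at C (mirror x)) (at C (mirror (suc x)))
    mirror-step {zero}  _    = Edge-sym G at-close
    mirror-step {suc x} x+2< =
      subst (λ i → Edge G (at C i) (at C (1 + k ∸ x))) (sym (+-∸-assoc 1 x≤1+k))
            (Edge-sym G (at-step (s≤s (s≤s (m∸n≤m (1 + k) x)))))
      where
      x≤1+k : x ≤ 1 + k
      x≤1+k = ≤-pred (≤-pred (<⇒≤ x+2<))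

    mirror-close : Edge G (at C (mirror (2 + k))) (at C 0)
    mirror-close = subst (λ i → Edge G (at C i) (at C 0)) (sym (m+n∸n≡m 1 k))
                         (Edge-sym G (at-step (s≤s (s≤s z≤n))))

  shortcut : ∀ {s d k′} → 1 ≤ d → k′ + d ≡ k → suc s + d < length C →
             Edge G (at C s) (at C (suc s + d)) → Σ (Cycle G u) λ C′ → ¬ OnCycle C′ (at C (suc s))
  shortcut {s} {d} {k′} d≥1 k′+d≡k s+1+d< chord = C′ , misses
    where
    ι : ℕ → ℕ
    ι = skip s d

    s+1≤len : suc s ≤ length C
    s+1≤len = ≤-trans (m≤m+n (suc s) d) (<⇒≤ s+1+d<)

    ι< : ∀ {x} → x < 3 + k′ → ι x < length C
    ι< {x} x< with x ≤? s
    ... | yes x≤s = ≤-<-trans x≤s s+1≤len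
    ... | no  _   = subst (λ m → x + d < 3 + m) k′+d≡k (+-monoˡ-< d x<)

    ι-step : ∀ {x} → suc x < 3 + k′ → Edge G (at C (ι x)) (at C (ι (suc x)))
    ι-step {x} x+1< = by-position (suc x ≤? s) (x ≤? s)
      where
      edge : ∀ {i j} → ι x ≡ i → ι (suc x) ≡ j → Edge G (at C i) (at C j) →
             Edge G (at C (ι x)) (at C (ι (suc x)))
      edge refl refl e = e

      by-position : Dec (suc x ≤ s) → Dec (x ≤ s) → Edge G (at C (ι x)) (at C (ι (suc x)))
      by-position (yes x+1≤s) _ =
        edge (skip-low (≤-trans (n≤1+n x) x+1≤s)) (skip-low x+1≤s) (at-step (≤-<-trans x+1≤s s+1≤len))
      by-position (no x+1≰s) (yes x≤s) =
        edge (trans (skip-low x≤s) x≡s) (trans (skip-high (≰⇒> x+1≰s)) (cong (λ i → suc i + d) x≡s)) chord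
        where
        x≡s : x ≡ s
        x≡s = ≤-antisym x≤s (≤-pred (≰⇒> x+1≰s))
      by-position (no x+1≰s) (no x≰s) =
        edge (skip-high (≰⇒> x≰s)) (skip-high (≰⇒> x+1≰s))
             (at-step (subst (_< length C) (skip-high (≰⇒> x+1≰s)) (ι< x+1<)))

    s<2+k′ : s < 2 + k′
    s<2+k′ = ≤-pred (+-cancelʳ-≤ d (suc (suc s)) (3 + k′)
               (subst (λ m → suc (suc s) + d ≤ 3 + m) (sym k′+d≡k) s+1+d<))

    ι-close : Edge G (at C (ι (2 + k′))) (at C (ι 0))
    ι-close = subst (λ i → Edge G (at C i) (at C 0))
                    (sym (trans (skip-high s<2+k′) (cong (2 +_) k′+d≡k))) at-close

    C′ : Cycle G u
    C′ = reindex k′ ι refl ι< (λ _ _ → skip-injective) ι-step ι-close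

    misses : ¬ OnCycle C′ (at C (suc s))
    misses (x , x< , eq) = skip≢suc d≥1 x (at-injective (ι< x<) (≤-<-trans (m≤m+n (suc s) d) s+1+d<) eq)

-- Hulls and convexity

module _ {n} {G : Graph n} where

  cycleConvex : ∀ {T} → (∀ u → u ∉ T → (C : Cycle G u) → ¬ Within C (T ∪ ⁅ u ⁆)) → CycleConvex G T
  cycleConvex no-cycle u u∉T = uncurry (no-cycle u u∉T) ∘ fromCycleThrough

  Cycle⇒InHull : ∀ {S p} (C : Cycle G p) → (∀ {t} → t < length C → at C t ≢ p → at C t ∈ S) → InHull G S p
  Cycle⇒InHull {S} {p} C C⊆S∪p T S⊆T T-convex with p ∈? T
  ... | yes p∈T = p∈T
  ... | no  p∉T = contradiction (toCycleThrough C C⊆T∪p) (T-convex p p∉T)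
    where
    C⊆T∪p : Within C (T ∪ ⁅ p ⁆)
    C⊆T∪p {t} t< with at C t ≟ p
    ... | yes ≡p = x∈p∪q⁺ (inj₂ (subst (_∈ ⁅ p ⁆) (sym ≡p) (x∈⁅x⁆ p)))
    ... | no  ≢p = x∈p∪q⁺ (inj₁ (S⊆T (C⊆S∪p t< ≢p)))

  neighbour-on-cycle : MaxDegree≤2 G → ∀ {u x y} (C : Cycle G u) → OnCycle C x → Edge G x y → OnCycle C y
  neighbour-on-cycle deg {y = y} C (t , t< , refl) e with onCycle? C y
  ... | yes y∈C = y∈C
  ... | no  y∉C with two-neighbours C t<
  ... | a , b , a< , b< , a≢b , ea , eb with deg ea eb e
  ... | inj₁ eq          = contradiction (Cycle.at-injective C a< b< eq) a≢b
  ... | inj₂ (inj₁ refl) = contradiction (a , a< , refl) y∉C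
  ... | inj₂ (inj₂ refl) = contradiction (b , b< , refl) y∉C

  connected⇒Hamiltonian : MaxDegree≤2 G → Connected G → ∀ {u} (C : Cycle G u) → Hamiltonian C
  connected⇒Hamiltonian deg conn C v =
    preserved-along-walk G (OnCycle C) (neighbour-on-cycle deg C) (conn (at C 0) v) (0 , s≤s z≤n , refl)

  missing-two⇒CycleConvex : MaxDegree≤2 G → Connected G →
                            ∀ {T a b} → a ∉ T → b ∉ T → a ≢ b → CycleConvex G T
  missing-two⇒CycleConvex deg conn {T} {a} {b} a∉T b∉T a≢b = cycleConvex λ u _ C C⊆T∪u →
    some-vertex-missing u (Hamiltonian∧Within⇒∈ C (connected⇒Hamiltonian deg conn C) C⊆T∪u)
    where
    some-vertex-missing : ∀ u → ¬ (∀ v → v ∈ T ∪ ⁅ u ⁆)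
    some-vertex-missing u everything with a ≟ u
    ... | yes refl = [ b∉T , (a≢b ∘ sym) ∘ x∈⁅y⁆⇒x≡y a ]′ (x∈p∪q⁻ T ⁅ a ⁆ (everything b))
    ... | no  a≢u  = [ a∉T , a≢u ∘ x∈⁅y⁆⇒x≡y u ]′ (x∈p∪q⁻ T ⁅ u ⁆ (everything a))

  ∁⁅x⁆-independent : MaxDegree≤2 G → Connected G → ∀ {x} → Cycle G x → CaratheodoryIndependent G (∁ ⁅ x ⁆)
  ∁⁅x⁆-independent deg conn {x} C = x , Cycle⇒InHull C (λ _ → x≢y⇒x∈∁⁅y⁆) , x∉⟨∁⁅x⁆-a⟩
    where
    x∉⟨∁⁅x⁆-a⟩ : ∀ a → a ∈ ∁ ⁅ x ⁆ → ¬ InHull G (∁ ⁅ x ⁆ - a) x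
    x∉⟨∁⁅x⁆-a⟩ a a∈∁⁅x⁆ x∈⟨∁⁅x⁆-a⟩ = x∉∁⁅x⁆ x (p─q⊆p _ _ (x∈⟨∁⁅x⁆-a⟩ (∁ ⁅ x ⁆ - a) id convex))
      where
      convex : CycleConvex G (∁ ⁅ x ⁆ - a)
      convex = missing-two⇒CycleConvex deg conn (x∉∁⁅x⁆ x ∘ p─q⊆p _ _)
                 (λ a∈ → x∈p─q⇒x∉q (∁ ⁅ x ⁆) ⁅ a ⁆ a∈ (x∈⁅x⁆ a)) λ { refl → x∉∁⁅x⁆ x a∈∁⁅x⁆ }

module _ {n} {G : Graph n} {S : Subset n} where

  independent-witness-∉ : ∀ {p} → (∀ a → a ∈ S → ¬ InHull G (S - a) p) → 2 ≤ ∣ S ∣ → p ∉ S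
  independent-witness-∉ {p} p∉⟨S-a⟩ 2≤∣S∣ p∈S with any? (λ a → (a ∈? S) ×-dec ¬? (a ≟ p))
  ... | yes (a , a∈S , a≢p) = p∉⟨S-a⟩ a a∈S λ T S-a⊆T _ → S-a⊆T (x∈p∧x≢y⇒x∈p-y p∈S (a≢p ∘ sym))
  ... | no  ∄a              = ≤⇒≯ ∣S∣≤1 2≤∣S∣
    where
    S⊆⁅p⁆ : S ⊆ ⁅ p ⁆
    S⊆⁅p⁆ {x} x∈S with x ≟ p
    ... | yes refl = x∈⁅x⁆ p
    ... | no  x≢p  = contradiction (x , x∈S , x≢p) ∄a
    ∣S∣≤1 : ∣ S ∣ ≤ 1
    ∣S∣≤1 = ≤-trans (p⊆q⇒∣p∣≤∣q∣ S⊆⁅p⁆) (≤-reflexive (∣⁅x⁆∣≡1 p))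

  independent⇒∣S∣≤n∸1 : 2 ≤ n → CaratheodoryIndependent G S → ∣ S ∣ ≤ n ∸ 1
  independent⇒∣S∣≤n∸1 2≤n (p , _ , p∉⟨S-a⟩) with 2 ≤? ∣ S ∣
  ... | yes 2≤∣S∣ = x∉p⇒∣p∣≤n∸1 (independent-witness-∉ p∉⟨S-a⟩ 2≤∣S∣)
  ... | no  2≰∣S∣ = ≤-trans (≤-pred (≰⇒> 2≰∣S∣)) (∸-monoˡ-≤ 1 2≤n)

-- The cycle graph

module _ {n} {G : Graph n} where

  IsoToCycle⇒MaxDegree≤2 : IsoToCycle G → MaxDegree≤2 G
  IsoToCycle⇒MaxDegree≤2 (f , (_ , f-surjective) , f-adj) {w} {x} {y} {z} ex ey ez
    with preimage w | preimage x | preimage y | preimage z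
    where preimage = surjective⇒strictlySurjective f-surjective
  ... | i , refl | a , refl | b , refl | c , refl =
    Sum.map f-cong (Sum.map f-cong f-cong)
      (CycAdjℕ-three (toℕ<n a) (toℕ<n b) (toℕ<n c)
                     (proj₁ (f-adj i a) ex) (proj₁ (f-adj i b) ey) (proj₁ (f-adj i c) ez))
    where
    f-cong : ∀ {i j} → toℕ i ≡ toℕ j → f i ≡ f j
    f-cong = cong f ∘ toℕ-injective

  IsoToCycle⇒Cycle : 3 ≤ n → IsoToCycle G → ∃ (Cycle G)
  IsoToCycle⇒Cycle (s≤s (s≤s (s≤s {n = k} z≤n))) (f , (f-injective , _) , f-adj) =
    f zero , proj₁ (fromCycleThrough {X = ⊤} (k , f , f-injective , (λ _ → ∈⊤) , refl , step , close))
    where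
    step : ∀ (i : Fin (2 + k)) → Edge G (f (inject₁ i)) (f (suc i))
    step i = proj₂ (f-adj _ _) (inj₁ (cong suc (sym (toℕ-inject₁ i))))
    close : Edge G (f (fromℕ (2 + k))) (f zero)
    close = proj₂ (f-adj _ _) (inj₂ (inj₂ (inj₂ (refl , cong suc (toℕ-fromℕ (2 + k))))))

CycleIso : ∀ {n} → Graph n → (Fin n → Fin n) → Set
CycleIso G f =
  Bijective _≡_ _≡_ f × (∀ i j → (Edge G (f i) (f j) → CycAdj i j) × (CycAdj i j → Edge G (f i) (f j)))

CycleIso-stable : ∀ {n} (G : Graph n) f → Stable (CycleIso G f)
CycleIso-stable {n} G f ¬¬iso = (injective , surjective) , λ i j → edge⇒adj i j , adj⇒edge i j
  where
  injective : Injective _≡_ _≡_ f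
  injective {i} {j} eq = decidable-stable (i ≟ j) (¬¬-map (λ iso → proj₁ (proj₁ iso) eq) ¬¬iso)
  surjective : Surjective _≡_ _≡_ f
  surjective y with decidable-stable (any? λ x → f x ≟ y)
                      (¬¬-map (λ iso → surjective⇒strictlySurjective (proj₂ (proj₁ iso)) y) ¬¬iso)
  ... | x , fx≡y = x , λ { refl → fx≡y }
  edge⇒adj : ∀ i j → Edge G (f i) (f j) → CycAdj i j
  edge⇒adj i j e =
    decidable-stable (CycAdjℕ? n (toℕ i) (toℕ j)) (¬¬-map (λ iso → proj₁ (proj₂ iso i j) e) ¬¬iso)
  adj⇒edge : ∀ i j → CycAdj i j → Edge G (f i) (f j)
  adj⇒edge i j adj =
    decidable-stable (Edge? G (f i) (f j)) (¬¬-map (λ iso → proj₂ (proj₂ iso i j) adj) ¬¬iso)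

-- From Carathéodory number n − 1 to the cycle graph

module _ {n} {G : Graph n} {S : Subset n} {p : Fin n} (∁⁅p⁆⊆S : ∁ ⁅ p ⁆ ⊆ S) where

  every-cycle-Hamiltonian : (∀ a → a ∈ S → ¬ InHull G (S - a) p) → (C : Cycle G p) → Hamiltonian C
  every-cycle-Hamiltonian p∉⟨S-a⟩ C v with v ≟ p | onCycle? C v
  ... | yes refl | _       = 0 , s≤s z≤n , Cycle.at-zero C
  ... | no  _    | yes v∈C = v∈C
  ... | no  v≢p  | no  v∉C =
    contradiction (Cycle⇒InHull C C⊆S-v) (p∉⟨S-a⟩ v (∁⁅p⁆⊆S (x≢y⇒x∈∁⁅y⁆ v≢p)))
    where
    C⊆S-v : ∀ {t} → t < length C → at C t ≢ p → at C t ∈ S - v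
    C⊆S-v t< ≢p = x∈p∧x≢y⇒x∈p-y (∁⁅p⁆⊆S (x≢y⇒x∈∁⁅y⁆ ≢p)) λ ≡v → v∉C (_ , t< , ≡v)

  ¬¬Cycle : InHull G S p → p ∉ S → ¬ ¬ Cycle G p
  ¬¬Cycle p∈⟨S⟩ p∉S ∄C = p∉S (p∈⟨S⟩ S id (cycleConvex no-cycle))
    where
    no-cycle : ∀ u → u ∉ S → (C : Cycle G u) → ¬ Within C (S ∪ ⁅ u ⁆)
    no-cycle u u∉S C _ with u ≟ p
    ... | yes refl = ∄C C
    ... | no  u≢p  = u∉S (∁⁅p⁆⊆S (x≢y⇒x∈∁⁅y⁆ u≢p))

module _ {n} {G : Graph n} {u : Fin n} (ham : ∀ (C : Cycle G u) → Hamiltonian C) where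

  Hamiltonian⇒¬chord : (C : Cycle G u) → ∀ {s t} → s < t → t < length C → ¬ CycAdjℕ (length C) s t →
                       ¬ Edge G (at C s) (at C t)
  Hamiltonian⇒¬chord C s<t t< ¬adj chord with chord-gap s<t t< ¬adj
  ... | d , k′ , d≥1 , k′+d≡k , refl with shortcut C d≥1 k′+d≡k t< chord
  ... | C′ , misses = misses (ham C′ _)

  Hamiltonian⇒Chordless : (C : Cycle G u) → Chordless C
  Hamiltonian⇒Chordless C {s} {t} s< t< e with CycAdjℕ? (length C) s t
  ... | yes adj = adj
  ... | no ¬adj with <-cmp s t
  ... | tri< s<t _ _  = contradiction e (Hamiltonian⇒¬chord C s<t t< ¬adj)
  ... | tri≈ _ refl _ = contradiction refl (Edge⇒≢ G e)
  ... | tri> _ _ t<s  = contradiction (Edge-sym G e) (Hamiltonian⇒¬chord C t<s s< (¬adj ∘ CycAdjℕ-sym))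

module _ {n} (G : Graph n) where

  -- Some neighbour of v other than w; the junk value v if there is none.
  otherNeighbour : Fin n → Fin n → Fin n
  otherNeighbour w v with any? (λ x → Edge? G v x ×-dec ¬? (x ≟ w))
  ... | yes (x , _) = x
  ... | no  _       = v

  otherNeighbour-spec : ∀ {w v x} → Edge G v x → x ≢ w →
                        Edge G v (otherNeighbour w v) × otherNeighbour w v ≢ w
  otherNeighbour-spec {w} {v} {x} e x≢w with any? (λ x → Edge? G v x ×-dec ¬? (x ≟ w))
  ... | yes (_ , spec) = spec
  ... | no  ∄x         = contradiction (x , e , x≢w) ∄x

  greedyWalk : Fin n → ℕ → Fin n
  greedyWalk p zero          = p
  greedyWalk p (suc zero)    = otherNeighbour p p
  greedyWalk p (suc (suc t)) = otherNeighbour (greedyWalk p t) (greedyWalk p (suc t))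

  greedyWalk-first : ∀ {p x} → Edge G p x → Edge G p (greedyWalk p 1)
  greedyWalk-first e = proj₁ (otherNeighbour-spec e (Edge⇒≢ G e ∘ sym))

module _ {n} {G : Graph n} {u : Fin n} (C : Cycle G u) (ham : Hamiltonian C) (chordless : Chordless C) where
  open Cycle C using (k; at-injective; at-zero; at-step)

  neighbour-position : ∀ {t y} → t < length C → Edge G (at C t) y →
                       ∃ λ j → j < length C × CycAdjℕ (length C) t j × at C j ≡ y
  neighbour-position {y = y} t< e with ham y
  ... | j , j< , refl = j , j< , chordless t< j< e , refl

  neighbours-of-start : ∀ {y} → Edge G u y → y ≡ at C 1 ⊎ y ≡ at C (2 + k)
  neighbours-of-start {y} e with neighbour-position (s≤s z≤n) (subst (λ v → Edge G v y) (sym at-zero) e)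
  ... | _ , _ , inj₁ refl , refl                         = inj₁ refl
  ... | _ , _ , inj₂ (inj₂ (inj₁ (_ , 1+j≡len))) , refl = inj₂ (cong (at C ∘ pred) 1+j≡len)
  ... | _ , _ , inj₂ (inj₂ (inj₂ (_ , ()))) , _

  successor-unique : ∀ {t y} → suc (suc t) < length C → Edge G (at C (suc t)) y → y ≢ at C t →
                     y ≡ at C (suc (suc t))
  successor-unique t+2< e y≢at-t with neighbour-position (<-trans (n<1+n _) t+2<) e
  ... | _ , _ , inj₁ refl , refl                      = refl
  ... | _ , _ , inj₂ (inj₁ refl) , refl               = contradiction refl y≢at-t
  ... | _ , _ , inj₂ (inj₂ (inj₂ (_ , 2+t≡len))) , _ = contradiction t+2< (<-irrefl 2+t≡len)

  greedyWalk-follows : at C 1 ≡ greedyWalk G u 1 → ∀ {t} → t < length C → greedyWalk G u t ≡ at C t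
  greedyWalk-follows at₁≡ {zero}  _    = sym at-zero
  greedyWalk-follows at₁≡ {suc t} t+1< = proj₂ (follows-pair t+1<)
    where
    follows-pair : ∀ {t} → suc t < length C →
                   greedyWalk G u t ≡ at C t × greedyWalk G u (suc t) ≡ at C (suc t)
    follows-pair {zero}  _    = sym at-zero , sym at₁≡
    follows-pair {suc t} t+2< with follows-pair {t} (<-trans (n<1+n _) t+2<)
    ... | walk≡t , walk≡t+1 = walk≡t+1 , (begin
      greedyWalk G u (2 + t)                   ≡⟨ cong₂ (otherNeighbour G) walk≡t walk≡t+1 ⟩
      otherNeighbour G (at C t) (at C (1 + t)) ≡⟨ successor-unique t+2< (proj₁ spec) (proj₂ spec) ⟩
      at C (2 + t)                             ∎)
      where
      open ≡-Reasoning
      spec = otherNeighbour-spec G (at-step t+2<)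
               (m≢1+n+m t ∘ sym ∘ at-injective t+2< (<-trans (n<1+n _) (<-trans (n<1+n _) t+2<)))

  Hamiltonian∧Chordless⇒CycleIso : (w : ℕ → Fin n) → (∀ {t} → t < length C → w t ≡ at C t) →
                                    CycleIso G (w ∘ toℕ)
  Hamiltonian∧Chordless⇒CycleIso w w≡at = (injective , surjective) , λ i j → edge⇒adj i j , adj⇒edge i j
    where
    len≡n : length C ≡ n
    len≡n = Hamiltonian⇒length≡n C ham
    toℕ<len : ∀ (i : Fin n) → toℕ i < length C
    toℕ<len i = subst (toℕ i <_) (sym len≡n) (toℕ<n i)
    w≡at′ : ∀ i → w (toℕ i) ≡ at C (toℕ i)
    w≡at′ i = w≡at (toℕ<len i)
    injective : Injective _≡_ _≡_ (w ∘ toℕ)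
    injective {i} {j} eq =
      toℕ-injective (at-injective (toℕ<len i) (toℕ<len j) (trans (sym (w≡at′ i)) (trans eq (w≡at′ j))))
    surjective : Surjective _≡_ _≡_ (w ∘ toℕ)
    surjective y with ham y
    ... | t , t< , refl = fromℕ< t<n , λ { refl → trans (w≡at′ _) (cong (at C) (toℕ-fromℕ< t<n)) }
      where
      t<n : t < n
      t<n = subst (t <_) len≡n t<
    edge⇒adj : ∀ i j → Edge G (w (toℕ i)) (w (toℕ j)) → CycAdj i j
    edge⇒adj i j e = subst (λ m → CycAdjℕ m (toℕ i) (toℕ j)) len≡n
      (chordless (toℕ<len i) (toℕ<len j) (subst₂ (Edge G) (w≡at′ i) (w≡at′ j) e))
    adj⇒edge : ∀ i j → CycAdj i j → Edge G (w (toℕ i)) (w (toℕ j))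
    adj⇒edge i j adj = subst₂ (Edge G) (sym (w≡at′ i)) (sym (w≡at′ j))
      (CycAdjℕ⇒Edge C (toℕ<len i) (toℕ<len j) (subst (λ m → CycAdjℕ m (toℕ i) (toℕ j)) (sym len≡n) adj))

module _ {n} {G : Graph n} {p : Fin n} where

  Hamiltonian-cycles⇒IsoToCycle : (∀ (C : Cycle G p) → Hamiltonian C) → ¬ ¬ Cycle G p → IsoToCycle G
  Hamiltonian-cycles⇒IsoToCycle ham ¬¬C = greedyWalk G p ∘ toℕ , CycleIso-stable G _ (¬¬-map iso ¬¬C)
    where
    chordless : ∀ (C : Cycle G p) → Chordless C
    chordless = Hamiltonian⇒Chordless ham

    aligned : Cycle G p → Σ (Cycle G p) λ C → at C 1 ≡ greedyWalk G p 1
    aligned C with neighbours-of-start C (ham C) (chordless C) (greedyWalk-first G p→at₁)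
      where
      p→at₁ : Edge G p (at C 1)
      p→at₁ = subst (λ v → Edge G v (at C 1)) (Cycle.at-zero C) (Cycle.at-step C (s≤s (s≤s z≤n)))
    ... | inj₁ walk₁≡at₁  = C , sym walk₁≡at₁
    ... | inj₂ walk₁≡last = reverse C , sym walk₁≡last

    iso : Cycle G p → CycleIso G (greedyWalk G p ∘ toℕ)
    iso C₀ with aligned C₀
    ... | C , at₁≡ = Hamiltonian∧Chordless⇒CycleIso C (ham C) (chordless C) (greedyWalk G p)
                       (greedyWalk-follows C (ham C) (chordless C) at₁≡)

theorem4p8 : (n : ℕ) (G : Graph n) → 3 ≤ n → Connected G →
    (CarEq G (n ∸ 1) ⇔ IsoToCycle G)
theorem4p8 n G n≥3 conn = mk⇔ car⇒iso iso⇒car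
  where
  car⇒iso : CarEq G (n ∸ 1) → IsoToCycle G
  car⇒iso ((S , (p , p∈⟨S⟩ , p∉⟨S-a⟩) , ∣S∣≡n∸1) , _) =
    Hamiltonian-cycles⇒IsoToCycle (every-cycle-Hamiltonian {G = G} ∁⁅p⁆⊆S p∉⟨S-a⟩)
                                  (¬¬Cycle ∁⁅p⁆⊆S p∈⟨S⟩ p∉S)
    where
    p∉S : p ∉ S
    p∉S = independent-witness-∉ {G = G} p∉⟨S-a⟩ (subst (2 ≤_) (sym ∣S∣≡n∸1) (∸-monoˡ-≤ 1 n≥3))
    ∁⁅p⁆⊆S : ∁ ⁅ p ⁆ ⊆ S
    ∁⁅p⁆⊆S = ∣p∣≡n∸1⇒∁⁅x⁆⊆p ∣S∣≡n∸1 p∉S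

  iso⇒car : IsoToCycle G → CarEq G (n ∸ 1)
  iso⇒car iso with IsoToCycle⇒Cycle {G = G} n≥3 iso
  ... | x , C = (∁ ⁅ x ⁆ , ∁⁅x⁆-independent (IsoToCycle⇒MaxDegree≤2 {G = G} iso) conn C , ∣∁⁅x⁆∣≡n∸1 x) ,
                λ _ → independent⇒∣S∣≤n∸1 {G = G} (<⇒≤ n≥3)
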